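{- Let $\mathbf{C}$ be a category with a stable system of monics $\mathcal{M}$ and an $\mathcal{M}$-partial map classifier $(T,\eta)$, such that pushouts along $\mathcal{M}$-morphisms are stable under $\mathcal{M}$-pullbacks, pushouts along $\mathcal{M}$-morphisms are pullbacks, and $\mathcal{M}$-morphisms are stable under FPCs. Let $f:A\to B$ and $\beta:B\to B'$ be composable morphisms both in $\mathcal{M}$, and let $\mathrm{mIPC}(f,\beta)$ denote the class of pairs $(\alpha:A\to A',f':A'\to B')$ with $\alpha\in\mathcal{M}$ such that $f'\circ\alpha=\beta\circ f$ and $(f',\beta)$ is a pushout of the span $(\alpha,f)$. If $\mathrm{mIPC}(f,\beta)$ is non-empty, then it is essentially unique — for any two elements $(\alpha,f')$ and $(\gamma:A\to C',g':C'\to B')$ there is an isomorphism $\varphi:A'\to C'$ with $\gamma=\varphi\circ\alpha$ and $g'\circ\varphi=f'$ — and every element $(\alpha,f')$ yields a square that is both a pushout and a final pullback complement, i.e. $(\alpha,f')$ is an FPC of $(f,\beta)$.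
   Context: A stable system of monics is a class $\mathcal{M}$ of monomorphisms containing all isomorphisms, closed under composition, and stable under pullback. An $\mathcal{M}$-partial map classifier $(T,\eta)$ is a functor $T:\mathbf{C}\to\mathbf{C}$ with a natural transformation $\eta:\mathrm{Id}\Rightarrow T$ such that each $\eta_X\in\mathcal{M}$ and for each span $A\xleftarrow{m}X\xrightarrow{h}B$ with $m\in\mathcal{M}$ there is a unique $\varphi(m,h):A\to T(B)$ such that $(m,h)$ is a pullback of $(\varphi(m,h),\eta_B)$. Given composable $f:A\to B$, $m:B\to C$, a pair $(n:A\to F,g:F\to C)$ is a final pullback complement (FPC) of $(f,m)$ if $g\circ n=m\circ f$, this square is a pullback, and for every pullback square $d\circ y=m\circ z$ ($z:X\to B$, $y:X\to Y$, $d:Y\to C$) and every $x:X\to A$ with $f\circ x=z$ there is a unique $x':Y\to F$ with $g\circ x'=d$ and $x'\circ y=n\circ x$. Pushouts along $\mathcal{M}$-morphisms are stable under $\mathcal{M}$-pullbacks if for every commutative cube whose bottom face is a pushout of a span with one leg in $\mathcal{M}$, whose four vertical faces are pullbacks and whose four vertical morphisms are in $\mathcal{M}$, the top face is a pushout. Pushouts along $\mathcal{M}$-morphisms are pullbacks means every pushout square of a span with one leg in $\mathcal{M}$ is also a pullback square. $\mathcal{M}$-morphisms are stable under FPCs if whenever $f,m\in\mathcal{M}$ and $(n,g)$ is an FPC of $(f,m)$, then $g\in\mathcal{M}$. -}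

module Defs where

open import Level using (Level; _⊔_; suc)
open import Data.Product using (Σ; Σ-syntax; _×_; _,_)
open import Data.Sum using (_⊎_)
open import Relation.Binary using (IsEquivalence)

record Category (o ℓ e : Level) : Set (suc (o ⊔ ℓ ⊔ e)) where
  infix  4 _≈_
  infixr 9 _∘_
  field
    Obj   : Set o
    Hom   : Obj → Obj → Set ℓ
    _≈_   : ∀ {A B} → Hom A B → Hom A B → Set e
    id    : ∀ {A} → Hom A A
    _∘_   : ∀ {A B C} → Hom B C → Hom A B → Hom A C
    ≈-equiv : ∀ {A B} → IsEquivalence (_≈_ {A} {B})
    ∘-resp-≈ : ∀ {A B C} {f h : Hom B C} {g i : Hom A B} →
               f ≈ h → g ≈ i → f ∘ g ≈ h ∘ i
    assoc : ∀ {A B C D} {f : Hom A B} {g : Hom B C} {h : Hom C D} →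
            (h ∘ g) ∘ f ≈ h ∘ (g ∘ f)
    identityˡ : ∀ {A B} {f : Hom A B} → id ∘ f ≈ f
    identityʳ : ∀ {A B} {f : Hom A B} → f ∘ id ≈ f

module _ {o ℓ e : Level} (𝒞 : Category o ℓ e) where
  open Category 𝒞

  MorClass : (p : Level) → Set (o ⊔ ℓ ⊔ suc p)
  MorClass p = ∀ {A B} → Hom A B → Set p

  IsMono : ∀ {A B} → Hom A B → Set (o ⊔ ℓ ⊔ e)
  IsMono {A} m = ∀ {X} (g h : Hom X A) → m ∘ g ≈ m ∘ h → g ≈ h

  IsIso : ∀ {A B} → Hom A B → Set (ℓ ⊔ e)
  IsIso {A} {B} f = Σ[ g ∈ Hom B A ] (g ∘ f ≈ id × f ∘ g ≈ id)

  record IsPullback {P A B C : Obj} (p₁ : Hom P A) (p₂ : Hom P B)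
                    (g : Hom A C) (f : Hom B C) : Set (o ⊔ ℓ ⊔ e) where
    field
      commute   : g ∘ p₁ ≈ f ∘ p₂
      universal : ∀ {X} (q₁ : Hom X A) (q₂ : Hom X B) → g ∘ q₁ ≈ f ∘ q₂ →
                  Σ[ u ∈ Hom X P ] ((p₁ ∘ u ≈ q₁) × (p₂ ∘ u ≈ q₂) ×
                    (∀ (u' : Hom X P) → p₁ ∘ u' ≈ q₁ → p₂ ∘ u' ≈ q₂ → u' ≈ u))

  record IsPushout {A B C Q : Obj} (f : Hom A B) (g : Hom A C)
                   (i₁ : Hom B Q) (i₂ : Hom C Q) : Set (o ⊔ ℓ ⊔ e) where
    field
      commute   : i₁ ∘ f ≈ i₂ ∘ g
      universal : ∀ {X} (q₁ : Hom B X) (q₂ : Hom C X) → q₁ ∘ f ≈ q₂ ∘ g →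
                  Σ[ u ∈ Hom Q X ] ((u ∘ i₁ ≈ q₁) × (u ∘ i₂ ≈ q₂) ×
                    (∀ (u' : Hom Q X) → u' ∘ i₁ ≈ q₁ → u' ∘ i₂ ≈ q₂ → u' ≈ u))

  record IsStableSystem {p : Level} (M : MorClass p) : Set (o ⊔ ℓ ⊔ e ⊔ p) where
    field
      M-resp-≈  : ∀ {A B} {f g : Hom A B} → f ≈ g → M f → M g
      M-mono    : ∀ {A B} {m : Hom A B} → M m → IsMono m
      M-iso     : ∀ {A B} {f : Hom A B} → IsIso f → M f
      M-∘       : ∀ {A B C} {f : Hom A B} {g : Hom B C} → M f → M g → M (g ∘ f)
      M-pullback : ∀ {A B C} (m : Hom A C) (h : Hom B C) → M m →
                   Σ[ P ∈ Obj ] Σ[ p₁ ∈ Hom P A ] Σ[ p₂ ∈ Hom P B ]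
                     IsPullback p₁ p₂ m h
      M-stable  : ∀ {P A B C} {p₁ : Hom P A} {p₂ : Hom P B} {m : Hom B C} {h : Hom A C} →
                  M m → IsPullback p₁ p₂ h m → M p₁

  record PartialMapClassifier {p : Level} (M : MorClass p) : Set (o ⊔ ℓ ⊔ e ⊔ p) where
    field
      T₀ : Obj → Obj
      T₁ : ∀ {A B} → Hom A B → Hom (T₀ A) (T₀ B)
      T-resp-≈ : ∀ {A B} {f g : Hom A B} → f ≈ g → T₁ f ≈ T₁ g
      T-id     : ∀ {A} → T₁ (id {A}) ≈ id
      T-∘      : ∀ {A B C} {f : Hom A B} {g : Hom B C} → T₁ (g ∘ f) ≈ T₁ g ∘ T₁ f
      η        : ∀ X → Hom X (T₀ X)
      η-natural : ∀ {A B} (f : Hom A B) → T₁ f ∘ η A ≈ η B ∘ f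
      η-in-M   : ∀ X → M (η X)
      classify : ∀ {A X B} (m : Hom X A) (h : Hom X B) → M m →
                 Σ[ φ ∈ Hom A (T₀ B) ] (IsPullback m h φ (η B) ×
                   (∀ (ψ : Hom A (T₀ B)) → IsPullback m h ψ (η B) → ψ ≈ φ))

  record IsFPC {A B C F : Obj} (f : Hom A B) (m : Hom B C)
               (n : Hom A F) (g : Hom F C) : Set (o ⊔ ℓ ⊔ e) where
    field
      pullback : IsPullback n f g m
      final : ∀ {X Y} (z : Hom X B) (y : Hom X Y) (d : Hom Y C) →
              IsPullback y z d m → (x : Hom X A) → f ∘ x ≈ z →
              Σ[ x' ∈ Hom Y F ] ((g ∘ x' ≈ d) × (x' ∘ y ≈ n ∘ x) ×
                (∀ (x'' : Hom Y F) → g ∘ x'' ≈ d → x'' ∘ y ≈ n ∘ x → x'' ≈ x'))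

  PushoutsStableUnderMPullbacks : ∀ {p} → MorClass p → Set (o ⊔ ℓ ⊔ e ⊔ p)
  PushoutsStableUnderMPullbacks M =
    ∀ {A B C D A' B' C' D' : Obj}
      {b : Hom A B} {c : Hom A C} {d₁ : Hom B D} {d₂ : Hom C D}
      {b' : Hom A' B'} {c' : Hom A' C'} {d₁' : Hom B' D'} {d₂' : Hom C' D'}
      {vA : Hom A' A} {vB : Hom B' B} {vC : Hom C' C} {vD : Hom D' D} →
    IsPushout b c d₁ d₂ → (M b ⊎ M c) →
    M vA → M vB → M vC → M vD →
    d₁' ∘ b' ≈ d₂' ∘ c' →
    IsPullback vA b' b vB →
    IsPullback vA c' c vC →
    IsPullback vB d₁' d₁ vD →
    IsPullback vC d₂' d₂ vD →
    IsPushout b' c' d₁' d₂'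

  PushoutsAlongMArePullbacks : ∀ {p} → MorClass p → Set (o ⊔ ℓ ⊔ e ⊔ p)
  PushoutsAlongMArePullbacks M =
    ∀ {A B C D : Obj} {b : Hom A B} {c : Hom A C} {d₁ : Hom B D} {d₂ : Hom C D} →
    (M b ⊎ M c) → IsPushout b c d₁ d₂ → IsPullback b c d₁ d₂

  MStableUnderFPCs : ∀ {p} → MorClass p → Set (o ⊔ ℓ ⊔ e ⊔ p)
  MStableUnderFPCs M =
    ∀ {A B C F : Obj} {f : Hom A B} {m : Hom B C} {n : Hom A F} {g : Hom F C} →
    M f → M m → IsFPC f m n g → M g

  record MIPC {p : Level} (M : MorClass p) {A B B' : Obj}
              (f : Hom A B) (β : Hom B B') : Set (o ⊔ ℓ ⊔ e ⊔ p) where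
    constructor mipc
    field
      A'      : Obj
      α       : Hom A A'
      f'      : Hom A' B'
      α-in-M  : M α
      pushout : IsPushout α f f' β

{-# OPTIONS --safe #-}
-- The classifier supplies an FPC (n , g) of (f , β): the η-square of φ(η_A , f) is an
-- FPC, so φ(η_A , f) ∈ M, and pulling it back along φ(β , id) gives one for (f , β)
-- with g ∈ M.
-- For (α , f') in mIPC(f , β) the pushout square is a pullback, so finality yields
-- u : A' → F with u ∘ α ≈ n and g ∘ u ≈ f'. Pulling the pushout back along the cube
-- with vertical maps id, id, f, g turns it into a pushout of the span (α , id) whose
-- leg opposite id is u, so u is invertible. Hence (α , f') is itself an FPC, and
-- FPCs are unique up to isomorphism.
module Submission where

open import Level using (Level)
open import Data.Product using (Σ-syntax; _×_; _,_; proj₁; proj₂)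
open import Data.Sum using (inj₁)
open import Relation.Binary.Bundles using (Setoid)
open import Relation.Binary.Structures using (IsEquivalence)
import Relation.Binary.Reasoning.Setoid as SetoidReasoning
open import Defs

module Squares {o ℓ e : Level} (𝒞 : Category o ℓ e) where
  open Category 𝒞

  module Equiv {A B : Obj} = IsEquivalence (≈-equiv {A} {B})
  open Equiv public using (refl; sym; trans)

  hom-setoid : Obj → Obj → Setoid ℓ e
  hom-setoid A B = record { Carrier = Hom A B ; _≈_ = _≈_ ; isEquivalence = ≈-equiv }

  module HomReasoning {A B : Obj} = SetoidReasoning (hom-setoid A B)

  private variable
    A B C D F P X : Obj
    f g g' h h' m m' n n' p₁ p₂ q u ψ : Hom _ _

  refl⟩∘⟨_ : {f : Hom B C} {g h : Hom A B} → g ≈ h → f ∘ g ≈ f ∘ h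
  refl⟩∘⟨_ = ∘-resp-≈ refl

  _⟩∘⟨refl : {f g : Hom B C} {h : Hom A B} → f ≈ g → f ∘ h ≈ g ∘ h
  p ⟩∘⟨refl = ∘-resp-≈ p refl

  pullˡ : {a : Hom B C} {b : Hom A B} {c : Hom A C} {x : Hom X A} →
          a ∘ b ≈ c → a ∘ (b ∘ x) ≈ c ∘ x
  pullˡ p = trans (sym assoc) (p ⟩∘⟨refl)

  extendʳ : {a : Hom B D} {b : Hom A B} {c : Hom C D} {d : Hom A C} {x : Hom X A} →
            a ∘ b ≈ c ∘ d → a ∘ (b ∘ x) ≈ c ∘ (d ∘ x)
  extendʳ p = trans (pullˡ p) assoc

  cancelˡ : {a : Hom B A} {b : Hom A B} {x : Hom X A} → a ∘ b ≈ id → a ∘ (b ∘ x) ≈ x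
  cancelˡ p = trans (pullˡ p) identityˡ

  IsPullback-swap : IsPullback 𝒞 p₁ p₂ g f → IsPullback 𝒞 p₂ p₁ f g
  IsPullback-swap pb = record
    { commute = sym commute
    ; universal = λ q₁ q₂ eq →
        let (u , u₁ , u₂ , unique) = universal q₂ q₁ (sym eq)
        in u , u₂ , u₁ , λ u' v₁ v₂ → unique u' v₂ v₁
    }
    where open IsPullback pb

  IsPullback-unique-diagram : IsPullback 𝒞 p₁ p₂ g f → {a b : Hom X P} →
                              p₁ ∘ a ≈ p₁ ∘ b → p₂ ∘ a ≈ p₂ ∘ b → a ≈ b
  IsPullback-unique-diagram {p₁ = p₁} {p₂ = p₂} pb {a} {b} e₁ e₂ =
    let (_ , _ , _ , unique) = universal (p₁ ∘ b) (p₂ ∘ b) (extendʳ commute)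
    in trans (unique a e₁ e₂) (sym (unique b refl refl))
    where open IsPullback pb

  IsPullback-resp-≈ : {p₁ p₁' : Hom P A} {p₂ p₂' : Hom P B} {g g' : Hom A C} {f f' : Hom B C} →
                      p₁ ≈ p₁' → p₂ ≈ p₂' → g ≈ g' → f ≈ f' →
                      IsPullback 𝒞 p₁ p₂ g f → IsPullback 𝒞 p₁' p₂' g' f'
  IsPullback-resp-≈ e₁ e₂ eg ef pb = record
    { commute = trans (∘-resp-≈ (sym eg) (sym e₁)) (trans commute (∘-resp-≈ ef e₂))
    ; universal = λ q₁ q₂ eq →
        let (u , u₁ , u₂ , unique) =
              universal q₁ q₂ (trans (eg ⟩∘⟨refl) (trans eq (sym ef ⟩∘⟨refl)))
        in u , trans (sym e₁ ⟩∘⟨refl) u₁ , trans (sym e₂ ⟩∘⟨refl) u₂ ,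
           λ u' v₁ v₂ → unique u' (trans (e₁ ⟩∘⟨refl) v₁) (trans (e₂ ⟩∘⟨refl) v₂)
    }
    where open IsPullback pb

  IsPullback-paste : IsPullback 𝒞 p₁ p₂ h m → IsPullback 𝒞 m q h' m' →
                     IsPullback 𝒞 p₁ (q ∘ p₂) (h' ∘ h) m'
  IsPullback-paste {p₂ = p₂} {h = h} upper lower = record
    { commute = trans assoc (trans (refl⟩∘⟨ U.commute) (extendʳ L.commute))
    ; universal = λ q₁ q₂ eq →
        let (w , w₁ , w₂ , uniqueʷ) = L.universal (h ∘ q₁) q₂ (trans (sym assoc) eq)
            (u , u₁ , u₂ , uniqueᵘ) = U.universal q₁ w (sym w₁)
        in u , u₁ , trans assoc (trans (refl⟩∘⟨ u₂) w₂) ,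
           λ u' v₁ v₂ → uniqueᵘ u' v₁
             (uniqueʷ (p₂ ∘ u') (trans (extendʳ (sym U.commute)) (refl⟩∘⟨ v₁))
                                (trans (sym assoc) v₂))
    }
    where
    module U = IsPullback upper
    module L = IsPullback lower

  IsPullback-unpaste : h ∘ p₁ ≈ m ∘ p₂ → IsPullback 𝒞 m q h' m' →
                       IsPullback 𝒞 p₁ (q ∘ p₂) (h' ∘ h) m' → IsPullback 𝒞 p₁ p₂ h m
  IsPullback-unpaste {q = q} square lower outer = record
    { commute = square
    ; universal = λ q₁ q₂ eq →
        let (u , u₁ , u₂ , unique) =
              O.universal q₁ (q ∘ q₂) (trans assoc (trans (refl⟩∘⟨ eq) (extendʳ L.commute)))
        in u , u₁ ,
           IsPullback-unique-diagram lower
             (trans (extendʳ (sym square)) (trans (refl⟩∘⟨ u₁) eq))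
             (trans (sym assoc) u₂) ,
           λ u' v₁ v₂ → unique u' v₁ (trans assoc (refl⟩∘⟨ v₂))
    }
    where
    module L = IsPullback lower
    module O = IsPullback outer

  mono-pullback : IsMono 𝒞 g → g ∘ u ≈ h → IsPullback 𝒞 u id g h
  mono-pullback {u = u} mono factor = record
    { commute = trans factor (sym identityʳ)
    ; universal = λ q₁ q₂ eq →
        q₂ , mono (u ∘ q₂) q₁ (trans (pullˡ factor) (sym eq)) , identityˡ ,
        λ u' _ v₂ → trans (sym identityˡ) v₂
    }

  iso-pullback : IsIso 𝒞 ψ → g ∘ ψ ≈ g' → IsPullback 𝒞 g' ψ id g
  iso-pullback {ψ = ψ} {g = g} {g' = g'} (ψ⁻¹ , ψ⁻¹ψ , ψψ⁻¹) factor = record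
    { commute = trans identityˡ (sym factor)
    ; universal = λ q₁ q₂ eq →
        ψ⁻¹ ∘ q₂ ,
        (begin
           g' ∘ (ψ⁻¹ ∘ q₂)      ≈⟨ factor ⟩∘⟨refl ⟨
           (g ∘ ψ) ∘ (ψ⁻¹ ∘ q₂) ≈⟨ assoc ⟩
           g ∘ (ψ ∘ (ψ⁻¹ ∘ q₂)) ≈⟨ refl⟩∘⟨ cancelˡ ψψ⁻¹ ⟩
           g ∘ q₂               ≈⟨ trans (sym identityˡ) eq ⟨
           q₁                   ∎) ,
        cancelˡ ψψ⁻¹ ,
        λ u' _ v₂ → trans (sym (cancelˡ ψ⁻¹ψ)) (refl⟩∘⟨ v₂)
    }
    where open HomReasoning

  IsPushout-id⇒IsIso : {b : Hom A B} {d₁ : Hom B D} {d₂ : Hom A D} →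
                       IsPushout 𝒞 b id d₁ d₂ → IsIso 𝒞 d₁
  IsPushout-id⇒IsIso {b = b} {d₁ = d₁} {d₂ = d₂} po =
    let (k , k₁ , k₂ , _) = universal id b (trans identityˡ (sym identityʳ))
        (_ , _ , _ , unique) = universal d₁ d₂ commute
        d₁k∘d₁ = trans assoc (trans (refl⟩∘⟨ k₁) identityʳ)
        d₁k∘d₂ = trans assoc (trans (refl⟩∘⟨ k₂) (trans commute identityʳ))
    in k , k₁ , trans (unique (d₁ ∘ k) d₁k∘d₁ d₁k∘d₂) (sym (unique id identityˡ identityˡ))
    where open IsPushout po

  FPC-factor : IsFPC 𝒞 f m n g → IsPullback 𝒞 n' f g' m →
               Σ[ u ∈ Hom _ _ ] (g ∘ u ≈ g' × u ∘ n' ≈ n)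
  FPC-factor {f = f} {n' = n'} {g' = g'} fpc pb =
    let (u , gu , un' , _) = IsFPC.final fpc f n' g' pb id identityʳ
    in u , gu , trans un' identityʳ

  IsFPC-endo⇒id : IsFPC 𝒞 f m n g → g ∘ u ≈ g → u ∘ n ≈ n → u ≈ id
  IsFPC-endo⇒id {f = f} {n = n} {g = g} {u = u} fpc gu un =
    let (_ , _ , _ , unique) = final f n g pullback id identityʳ
    in trans (unique u gu (trans un (sym identityʳ)))
             (sym (unique id identityʳ (trans identityˡ (sym identityʳ))))
    where open IsFPC fpc

  IsFPC-unique : IsFPC 𝒞 f m n g → IsFPC 𝒞 f m n' g' →
                 Σ[ φ ∈ Hom _ _ ] (IsIso 𝒞 φ × φ ∘ n ≈ n' × g' ∘ φ ≈ g)
  IsFPC-unique fpc fpc' =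
    let (φ , g'φ , φn) = FPC-factor fpc' (IsFPC.pullback fpc)
        (ψ , gψ , ψn') = FPC-factor fpc (IsFPC.pullback fpc')
    in φ ,
       (ψ , IsFPC-endo⇒id fpc (trans (pullˡ gψ) g'φ) (trans assoc (trans (refl⟩∘⟨ φn) ψn'))
          , IsFPC-endo⇒id fpc' (trans (pullˡ g'φ) gψ) (trans assoc (trans (refl⟩∘⟨ ψn') φn))) ,
       φn , g'φ

  IsFPC-resp-iso : IsFPC 𝒞 f m n g → IsIso 𝒞 ψ → ψ ∘ n' ≈ n → g ∘ ψ ≈ g' →
                   IsFPC 𝒞 f m n' g'
  IsFPC-resp-iso {f = f} {m = m} {n = n} {g = g} {ψ = ψ} {n' = n'} {g' = g'}
                 fpc iso@(ψ⁻¹ , ψ⁻¹ψ , ψψ⁻¹) ψn' gψ = record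
    { pullback = IsPullback-swap (IsPullback-unpaste square (iso-pullback iso gψ) outer)
    ; final = final'
    }
    where
    open IsFPC fpc
    open HomReasoning

    square : m ∘ f ≈ g' ∘ n'
    square = begin
      m ∘ f         ≈⟨ IsPullback.commute pullback ⟨
      g ∘ n         ≈⟨ refl⟩∘⟨ ψn' ⟨
      g ∘ (ψ ∘ n')  ≈⟨ pullˡ gψ ⟩
      g' ∘ n'       ∎

    outer : IsPullback 𝒞 f (ψ ∘ n') (id ∘ m) g
    outer = IsPullback-resp-≈ refl (sym ψn') (sym identityˡ) refl (IsPullback-swap pullback)

    final' : ∀ {X Y} (z : Hom X _) (y : Hom X Y) (d : Hom Y _) →
             IsPullback 𝒞 y z d m → (x : Hom X _) → f ∘ x ≈ z →
             Σ[ x' ∈ Hom Y _ ] ((g' ∘ x' ≈ d) × (x' ∘ y ≈ n' ∘ x) ×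
               (∀ (x'' : Hom Y _) → g' ∘ x'' ≈ d → x'' ∘ y ≈ n' ∘ x → x'' ≈ x'))
    final' z y d pb x fx =
      let (x' , gx' , x'y , unique) = final z y d pb x fx
      in ψ⁻¹ ∘ x' ,
         (begin
            g' ∘ (ψ⁻¹ ∘ x')      ≈⟨ gψ ⟩∘⟨refl ⟨
            (g ∘ ψ) ∘ (ψ⁻¹ ∘ x') ≈⟨ assoc ⟩
            g ∘ (ψ ∘ (ψ⁻¹ ∘ x')) ≈⟨ refl⟩∘⟨ cancelˡ ψψ⁻¹ ⟩
            g ∘ x'               ≈⟨ gx' ⟩
            d                    ∎) ,
         (begin
            (ψ⁻¹ ∘ x') ∘ y       ≈⟨ assoc ⟩
            ψ⁻¹ ∘ (x' ∘ y)       ≈⟨ refl⟩∘⟨ x'y ⟩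
            ψ⁻¹ ∘ (n ∘ x)        ≈⟨ refl⟩∘⟨ pullˡ ψn' ⟨
            ψ⁻¹ ∘ (ψ ∘ (n' ∘ x)) ≈⟨ cancelˡ ψ⁻¹ψ ⟩
            n' ∘ x               ∎) ,
         λ x'' g'x'' x''y →
           let ψx''-unique = unique (ψ ∘ x'')
                 (trans (pullˡ gψ) g'x'')
                 (trans assoc (trans (refl⟩∘⟨ x''y) (pullˡ ψn')))
           in trans (sym (cancelˡ ψ⁻¹ψ)) (refl⟩∘⟨ ψx''-unique)

  IsFPC-pullback : {β : Hom B D} {h : Hom D C} {n₀ : Hom A F} {g₀ : Hom F C}
                   {p : Hom P F} {g : Hom P D} {n : Hom A P} →
                   IsFPC 𝒞 f m n₀ g₀ → IsPullback 𝒞 β id h m → IsPullback 𝒞 p g g₀ h →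
                   p ∘ n ≈ n₀ → g ∘ n ≈ β ∘ f → IsFPC 𝒞 f β n g
  IsFPC-pullback {f = f} {m = m} {β = β} {h = h} {n₀ = n₀} {g₀ = g₀} {p = p} {g = g} {n = n}
                 fpc β-pb F-pb pn gn = record
    { pullback = IsPullback-swap (IsPullback-unpaste (sym gn) (IsPullback-swap F-pb) outer)
    ; final = final'
    }
    where
    open IsFPC fpc
    open HomReasoning
    module F = IsPullback F-pb

    hβ : h ∘ β ≈ m
    hβ = trans (IsPullback.commute β-pb) identityʳ

    outer : IsPullback 𝒞 f (p ∘ n) (h ∘ β) g₀
    outer = IsPullback-resp-≈ refl (sym pn) (sym hβ) refl (IsPullback-swap pullback)

    final' : ∀ {X Y} (z : Hom X _) (y : Hom X Y) (d : Hom Y _) →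
             IsPullback 𝒞 y z d β → (x : Hom X _) → f ∘ x ≈ z →
             Σ[ x' ∈ Hom Y _ ] ((g ∘ x' ≈ d) × (x' ∘ y ≈ n ∘ x) ×
               (∀ (x'' : Hom Y _) → g ∘ x'' ≈ d → x'' ∘ y ≈ n ∘ x → x'' ≈ x'))
    final' z y d pb x fx =
      let pb' = IsPullback-resp-≈ refl identityˡ refl refl (IsPullback-paste pb β-pb)
          (c , g₀c , cy , uniqueᶜ) = final z y (h ∘ d) pb' x fx
          (x' , px' , gx' , uniqueˣ) = F.universal c d g₀c
          x'y = IsPullback-unique-diagram F-pb
            (begin
               p ∘ (x' ∘ y) ≈⟨ pullˡ px' ⟩
               c ∘ y        ≈⟨ cy ⟩
               n₀ ∘ x       ≈⟨ pullˡ pn ⟨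
               p ∘ (n ∘ x)  ∎)
            (begin
               g ∘ (x' ∘ y) ≈⟨ pullˡ gx' ⟩
               d ∘ y        ≈⟨ IsPullback.commute pb ⟩
               β ∘ z        ≈⟨ refl⟩∘⟨ fx ⟨
               β ∘ (f ∘ x)  ≈⟨ extendʳ gn ⟨
               g ∘ (n ∘ x)  ∎)
      in x' , gx' , x'y ,
         λ x'' gx'' x''y → uniqueˣ x''
           (uniqueᶜ (p ∘ x'')
              (trans (extendʳ F.commute) (refl⟩∘⟨ gx''))
              (trans assoc (trans (refl⟩∘⟨ x''y) (pullˡ pn))))
           gx''

module Classifier {o ℓ e p : Level} {𝒞 : Category o ℓ e} {M : MorClass 𝒞 p}
                  (stable : IsStableSystem 𝒞 M) (classifier : PartialMapClassifier 𝒞 M) where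
  open Category 𝒞
  open Squares 𝒞
  open IsStableSystem stable
  open PartialMapClassifier classifier

  φ : ∀ {A X B} (m : Hom X A) (h : Hom X B) → M m → Hom A (T₀ B)
  φ m h Mm = proj₁ (classify m h Mm)

  φ-pullback : ∀ {A X B} {m : Hom X A} {h : Hom X B} {Mm : M m} →
               IsPullback 𝒞 m h (φ m h Mm) (η B)
  φ-pullback = proj₁ (proj₂ (classify _ _ _))

  φ-unique : ∀ {A X B} {m : Hom X A} {h : Hom X B} {Mm : M m} {ψ : Hom A (T₀ B)} →
             IsPullback 𝒞 m h ψ (η B) → ψ ≈ φ m h Mm
  φ-unique = proj₂ (proj₂ (classify _ _ _)) _

  η-square-FPC : ∀ {A B} (f : Hom A B) → IsFPC 𝒞 f (η B) (η A) (φ (η A) f (η-in-M A))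
  η-square-FPC {A} {B} f = record { pullback = φ-pullback ; final = final }
    where
    φf = φ (η A) f (η-in-M A)

    final : ∀ {X Y} (z : Hom X B) (y : Hom X Y) (d : Hom Y (T₀ B)) →
            IsPullback 𝒞 y z d (η B) → (x : Hom X A) → f ∘ x ≈ z →
            Σ[ x' ∈ Hom Y (T₀ A) ] ((φf ∘ x' ≈ d) × (x' ∘ y ≈ η A ∘ x) ×
              (∀ (x'' : Hom Y (T₀ A)) → φf ∘ x'' ≈ d → x'' ∘ y ≈ η A ∘ x → x'' ≈ x'))
    final z y d pb x fx =
      let My = M-stable (η-in-M B) pb
          c-pb = φ-pullback {m = y} {h = x} {Mm = My}
          φf∘c-pb = IsPullback-resp-≈ refl fx refl refl (IsPullback-paste c-pb φ-pullback)
      in φ y x My ,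
         trans (φ-unique {Mm = My} φf∘c-pb) (sym (φ-unique pb)) ,
         IsPullback.commute c-pb ,
         λ x'' φfx'' x''y → φ-unique (IsPullback-unpaste x''y φ-pullback
           (IsPullback-resp-≈ refl (sym fx) (sym φfx'') refl pb))

  FPC-exists : MStableUnderFPCs 𝒞 M → ∀ {A B B'} {f : Hom A B} {β : Hom B B'} → M f → M β →
               Σ[ F ∈ Obj ] Σ[ n ∈ Hom A F ] Σ[ g ∈ Hom F B' ] (IsFPC 𝒞 f β n g × M g)
  FPC-exists FPC-stable {A} {B} {f = f} {β} Mf Mβ =
    let M-φf = FPC-stable Mf (η-in-M B) (η-square-FPC f)
        (F , p , g , F-pb) = M-pullback φf φβ M-φf
        (n , pn , gn , _) = IsPullback.universal F-pb (η A) (β ∘ f) φf∘η≈φβ∘β∘f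
    in F , n , g , IsFPC-pullback (η-square-FPC f) φ-pullback F-pb pn gn ,
       M-stable M-φf (IsPullback-swap F-pb)
    where
    open HomReasoning
    φf = φ (η A) f (η-in-M A)
    φβ = φ β id Mβ

    φf∘η≈φβ∘β∘f : φf ∘ η A ≈ φβ ∘ (β ∘ f)
    φf∘η≈φβ∘β∘f = begin
      φf ∘ η A          ≈⟨ IsPullback.commute φ-pullback ⟩
      η B ∘ f           ≈⟨ refl⟩∘⟨ identityˡ ⟨
      η B ∘ (id ∘ f)    ≈⟨ extendʳ (IsPullback.commute φ-pullback) ⟨
      φβ ∘ (β ∘ f)      ∎

module _ {o ℓ e p : Level} {𝒞 : Category o ℓ e} {M : MorClass 𝒞 p}
         (stable : IsStableSystem 𝒞 M)
         (pushout-stable : PushoutsStableUnderMPullbacks 𝒞 M)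
         (pushout-pullback : PushoutsAlongMArePullbacks 𝒞 M) where
  open Category 𝒞
  open Squares 𝒞
  open IsStableSystem stable

  pushout-IsFPC : ∀ {A A' B B' F} {f : Hom A B} {β : Hom B B'} {α : Hom A A'} {f' : Hom A' B'}
                    {n : Hom A F} {g : Hom F B'} →
                  M f → M α → IsPushout 𝒞 α f f' β → IsFPC 𝒞 f β n g → M g →
                  IsFPC 𝒞 f β α f'
  pushout-IsFPC Mf Mα po fpc Mg =
    let (u , gu , uα) = FPC-factor fpc (pushout-pullback (inj₁ Mα) po)
        top = pushout-stable po (inj₁ Mα) M-id M-id Mf Mg (trans uα (sym identityʳ))
                (IsPullback-swap (mono-pullback (M-mono M-id) identityˡ))
                (mono-pullback (M-mono Mf) identityʳ)
                (IsPullback-swap (mono-pullback (M-mono Mg) gu))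
                (IsPullback-swap (IsFPC.pullback fpc))
    in IsFPC-resp-iso fpc (IsPushout-id⇒IsIso top) uα gu
    where
    M-id : ∀ {X} → M (id {X})
    M-id = M-iso (id , identityˡ , identityˡ)

proposition7 : ∀ {o ℓ e p : Level} (𝒞 : Category o ℓ e) (M : MorClass 𝒞 p) →
    IsStableSystem 𝒞 M → PartialMapClassifier 𝒞 M →
    PushoutsStableUnderMPullbacks 𝒞 M → PushoutsAlongMArePullbacks 𝒞 M →
    MStableUnderFPCs 𝒞 M →
    ∀ {A B B' : Category.Obj 𝒞} (f : Category.Hom 𝒞 A B) (β : Category.Hom 𝒞 B B') →
    M f → M β →
    ((X Y : MIPC 𝒞 M f β) →
      Σ[ φ ∈ Category.Hom 𝒞 (MIPC.A' X) (MIPC.A' Y) ]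
        (IsIso 𝒞 φ ×
         Category._≈_ 𝒞 (MIPC.α Y) (Category._∘_ 𝒞 φ (MIPC.α X)) ×
         Category._≈_ 𝒞 (Category._∘_ 𝒞 (MIPC.f' Y) φ) (MIPC.f' X)))
    × ((X : MIPC 𝒞 M f β) →
        IsPushout 𝒞 (MIPC.α X) f (MIPC.f' X) β × IsFPC 𝒞 f β (MIPC.α X) (MIPC.f' X))
proposition7 𝒞 M stable classifier pushout-stable pushout-pullback FPC-stable f β Mf Mβ
  with Classifier.FPC-exists stable classifier FPC-stable Mf Mβ
... | _ , _ , _ , fpc , Mg = essentially-unique , λ X → MIPC.pushout X , isFPC X
  where
  open Category 𝒞 using (Hom; _≈_; _∘_)
  open Squares 𝒞 using (IsFPC-unique; sym)

  isFPC : (X : MIPC 𝒞 M f β) → IsFPC 𝒞 f β (MIPC.α X) (MIPC.f' X)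
  isFPC (mipc _ _ _ Mα po) = pushout-IsFPC stable pushout-stable pushout-pullback Mf Mα po fpc Mg

  essentially-unique : (X Y : MIPC 𝒞 M f β) →
    Σ[ φ ∈ Hom (MIPC.A' X) (MIPC.A' Y) ]
      (IsIso 𝒞 φ × MIPC.α Y ≈ φ ∘ MIPC.α X × MIPC.f' Y ∘ φ ≈ MIPC.f' X)
  essentially-unique X Y =
    let (φ , iso , φα , f'φ) = IsFPC-unique (isFPC X) (isFPC Y) in φ , iso , sym φα , f'φ
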